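{- Let $X$ be a finite list of vectors in $\Lambda=\mathbb{Z}^n$ spanning $\mathbb{R}^n$, and for a positive integer $q$ let $qX=\{qx : x\in X\}$ (as a list). Then $$M_{qX}(x,y)=q^n\, M_X\!\left(\frac{x-1}{q}+1,\,y\right).$$
   Context: For a sublist $A\subseteq X$, $r(A)$ denotes the dimension of the real span $\langle A\rangle_{\mathbb{R}}$, $\langle A\rangle_{\mathbb{Z}}$ denotes the sublattice of $\Lambda$ generated by $A$, $\Lambda_A=\Lambda\cap\langle A\rangle_{\mathbb{R}}$, and $m(A)=[\Lambda_A:\langle A\rangle_{\mathbb{Z}}]$ (the index). The multiplicity Tutte polynomial of $X$ is $$M_X(x,y)=\sum_{A\subseteq X} m(A)\,(x-1)^{n-r(A)}(y-1)^{|A|-r(A)},$$ where the sum is over all sublists $A$ of $X$. -}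

module Defs where

open import Data.Nat as ℕ using (ℕ; zero; suc; _∸_; _≤_)
open import Data.Integer as ℤ using (ℤ)
open import Data.Rational as ℚ using (ℚ)
open import Data.Fin using (Fin)
open import Data.Fin.Subset using (Subset; _∈_; _∉_; _⊆_; ⊤; ∣_∣; inside; outside)
open import Data.Vec using (Vec; []; _∷_; lookup; replicate; zipWith; map)
open import Data.Product using (Σ; ∃; _×_; _,_)
open import Relation.Binary.PropositionalEquality using (_≡_; _≢_)

Config : ℕ → ℕ → Set
Config n k = Vec (Vec ℤ n) k

_+ᵥ_ : ∀ {n} → Vec ℤ n → Vec ℤ n → Vec ℤ n
_+ᵥ_ = zipWith ℤ._+_

_-ᵥ_ : ∀ {n} → Vec ℤ n → Vec ℤ n → Vec ℤ n
_-ᵥ_ = zipWith ℤ._-_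

_·ᵥ_ : ∀ {n} → ℤ → Vec ℤ n → Vec ℤ n
c ·ᵥ v = map (c ℤ.*_) v

0ᵥ : ∀ {n} → Vec ℤ n
0ᵥ = replicate _ (ℤ.+ 0)

comb : ∀ {n k} → Config n k → (Fin k → ℤ) → Vec ℤ n
comb [] c = 0ᵥ
comb (x ∷ X) c = (c Fin.zero ·ᵥ x) +ᵥ comb X (λ i → c (Fin.suc i))
  where import Data.Fin as Fin

SupportedOn : ∀ {k} → Subset k → (Fin k → ℤ) → Set
SupportedOn S c = ∀ i → i ∉ S → c i ≡ ℤ.+ 0

-- v ∈ ⟨A⟩_ℤ , where A is the sublist of X selected by S
InZSpan : ∀ {n k} → Config n k → Subset k → Vec ℤ n → Set
InZSpan X S v = Σ (_ → ℤ) λ c → SupportedOn S c × comb X c ≡ v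

-- v ∈ Λ_A = Λ ∩ ⟨A⟩_ℝ  (for integer vectors: some nonzero integer multiple lies in ⟨A⟩_ℤ)
InΛ : ∀ {n k} → Config n k → Subset k → Vec ℤ n → Set
InΛ X S v = Σ ℤ λ d → d ≢ ℤ.+ 0 × InZSpan X S (d ·ᵥ v)

LinIndep : ∀ {n k} → Config n k → Subset k → Set
LinIndep X T = ∀ (c : _ → ℤ) → SupportedOn T c → comb X c ≡ 0ᵥ → ∀ i → c i ≡ ℤ.+ 0

-- r(A) = dim ⟨A⟩_ℝ = r : the maximal size of a linearly independent sublist of A
IsRank : ∀ {n k} → Config n k → Subset k → ℕ → Set
IsRank X S r =
  (Σ (Subset _) λ T → T ⊆ S × LinIndep X T × ∣ T ∣ ≡ r)
  × (∀ T → T ⊆ S → LinIndep X T → ∣ T ∣ ≤ r)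

-- m(A) = [Λ_A : ⟨A⟩_ℤ] = m : there are exactly m cosets of ⟨A⟩_ℤ in Λ_A,
-- witnessed by a complete, irredundant system of representatives.
IsIndex : ∀ {n k} → Config n k → Subset k → ℕ → Set
IsIndex X S m = Σ (Fin m → Vec ℤ _) λ rep →
    (∀ j → InΛ X S (rep j))
  × (∀ j j' → InZSpan X S (rep j -ᵥ rep j') → j ≡ j')
  × (∀ v → InΛ X S v → ∃ λ j → InZSpan X S (v -ᵥ rep j))

-- X spans ℝ^n (equivalently: every lattice vector lies in the real span of X)
Spans : ∀ {n k} → Config n k → Set
Spans X = ∀ v → InΛ X ⊤ v

scale : ∀ {n k} → ℕ → Config n k → Config n k
scale q X = map ((ℤ.+ q) ·ᵥ_) X

sumSub : ∀ {k} → (Subset k → ℚ) → ℚ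
sumSub {zero} f = f []
sumSub {suc k} f = sumSub (λ s → f (outside ∷ s)) ℚ.+ sumSub (λ s → f (inside ∷ s))

_^ℚ_ : ℚ → ℕ → ℚ
x ^ℚ zero = ℚ.1ℚ
x ^ℚ suc e = x ℚ.* (x ^ℚ e)

MTutte : ∀ {k} → ℕ → (r m : Subset k → ℕ) → ℚ → ℚ → ℚ
MTutte n r m x y = sumSub λ A →
  ((ℤ.+ m A) ℚ./ 1) ℚ.* (((x ℚ.- ℚ.1ℚ) ^ℚ (n ∸ r A)) ℚ.* ((y ℚ.- ℚ.1ℚ) ^ℚ (∣ A ∣ ∸ r A)))

{-# OPTIONS --safe #-}

-- The identity holds term by term. Scaling preserves linear independence, so r_{qX} = r_X,
-- and m_{qX}(A) = q^{r(A)} m_X(A): for a basis T of A we have Λ_A = Λ_T, and computing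
-- [Λ_A : q⟨T⟩] in two ways gives m(T) q^{|T|} = m_{qX}(A) c, where c = [⟨A⟩ : ⟨T⟩] =
-- [q⟨A⟩ : q⟨T⟩] also satisfies m(T) = m(A) c. Cancelling c, the A-term of M_{qX} is
-- q^{r} m (x-1)^{n-r} (y-1)^{|A|-r} = q^n m ((x-1)/q)^{n-r} (y-1)^{|A|-r}.
-- Bases, the rank bound r ≤ n and Λ_A ⊆ Λ_T need linear dependence to be decidable,
-- which fraction-free Gaussian elimination provides.

module Submission where

open import Defs

module Lattice where

  open import Level using (0ℓ)
  open import Data.Nat as ℕ using (ℕ; zero; suc; _≤_; _<_; _^_; s≤s)
  import Data.Nat.Properties as ℕₚ
  open import Data.Integer as ℤ using (ℤ; +_; -[1+_]; _+_; _-_; _*_; -_; _/ℕ_; _%ℕ_)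
  import Data.Integer.Properties as ℤ
  open import Data.Integer.DivMod using (a≡a%ℕn+[a/ℕn]*n; n%ℕd<d)
  import Data.Nat.DivMod as ℕ
  open import Data.Integer.Tactic.RingSolver using (solve-∀)
  open import Data.Fin using (Fin; zero; suc; toℕ; fromℕ<; combine; remQuot)
  import Data.Fin.Properties as Fin
  open import Data.Fin.Subset as Subset using (Subset; _∈_; _∉_; _⊆_; _⊂_; inside; outside; ∣_∣; ⁅_⁆; _∪_)
  import Data.Fin.Subset.Properties as Subset
  open import Data.Vec using (Vec; []; _∷_; lookup; map; head; tail; here; there)
  open import Data.Vec.Properties using (lookup-map)
  open import Data.Product as Product using (Σ; ∃; ∃-syntax; _×_; _,_; proj₁; proj₂)
  open import Data.Sum as Sum using (_⊎_; inj₁; inj₂; [_,_]′)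
  open import Data.Empty using (⊥-elim)
  open import Function using (_∘_)
  open import Relation.Nullary using (¬_; yes; no)
  open import Relation.Nullary.Decidable using (¬?; _×-dec_; decidable-stable)
  open import Relation.Unary using (Pred) renaming (_⊆_ to _⊆ₚ_)
  open import Relation.Binary.PropositionalEquality

  private
    variable
      m n k : ℕ

  v-v≡0 : (v : Vec ℤ n) → v -ᵥ v ≡ 0ᵥ
  v-v≡0 []      = refl
  v-v≡0 (x ∷ v) = cong₂ _∷_ (ℤ.i≡j⇒i-j≡0 {x} refl) (v-v≡0 v)

  v-0≡v : (v : Vec ℤ n) → v -ᵥ 0ᵥ ≡ v
  v-0≡v []      = refl
  v-0≡v (x ∷ v) = cong₂ _∷_ (ℤ.+-identityʳ x) (v-0≡v v)

  +ᵥ-identityˡ : (v : Vec ℤ n) → 0ᵥ +ᵥ v ≡ v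
  +ᵥ-identityˡ []      = refl
  +ᵥ-identityˡ (x ∷ v) = cong₂ _∷_ (ℤ.+-identityˡ x) (+ᵥ-identityˡ v)

  +ᵥ-identityʳ : (v : Vec ℤ n) → v +ᵥ 0ᵥ ≡ v
  +ᵥ-identityʳ []      = refl
  +ᵥ-identityʳ (x ∷ v) = cong₂ _∷_ (ℤ.+-identityʳ x) (+ᵥ-identityʳ v)

  [u-w]-[v-w]≡u-v : (u v w : Vec ℤ n) → (u -ᵥ w) -ᵥ (v -ᵥ w) ≡ u -ᵥ v
  [u-w]-[v-w]≡u-v []      []      []      = refl
  [u-w]-[v-w]≡u-v (x ∷ u) (y ∷ v) (z ∷ w) = cong₂ _∷_ (ring x y z) ([u-w]-[v-w]≡u-v u v w)
    where ring : ∀ x y z → (x - z) - (y - z) ≡ x - y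
          ring = solve-∀

  0-[u-v]≡v-u : (u v : Vec ℤ n) → 0ᵥ -ᵥ (u -ᵥ v) ≡ v -ᵥ u
  0-[u-v]≡v-u []      []      = refl
  0-[u-v]≡v-u (x ∷ u) (y ∷ v) = cong₂ _∷_ (ring x y) (0-[u-v]≡v-u u v)
    where ring : ∀ x y → + 0 - (x - y) ≡ y - x
          ring = solve-∀

  u+v≡u-[0-v] : (u v : Vec ℤ n) → u +ᵥ v ≡ u -ᵥ (0ᵥ -ᵥ v)
  u+v≡u-[0-v] []      []      = refl
  u+v≡u-[0-v] (x ∷ u) (y ∷ v) = cong₂ _∷_ (ring x y) (u+v≡u-[0-v] u v)
    where ring : ∀ x y → x + y ≡ x - (+ 0 - y)
          ring = solve-∀

  [u+v]-u≡v : (u v : Vec ℤ n) → (u +ᵥ v) -ᵥ u ≡ v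
  [u+v]-u≡v []      []      = refl
  [u+v]-u≡v (x ∷ u) (y ∷ v) = cong₂ _∷_ (ring x y) ([u+v]-u≡v u v)
    where ring : ∀ x y → (x + y) - x ≡ y
          ring = solve-∀

  [w+u]-[w+v]≡u-v : (w u v : Vec ℤ n) → (w +ᵥ u) -ᵥ (w +ᵥ v) ≡ u -ᵥ v
  [w+u]-[w+v]≡u-v []      []      []      = refl
  [w+u]-[w+v]≡u-v (z ∷ w) (x ∷ u) (y ∷ v) = cong₂ _∷_ (ring z x y) ([w+u]-[w+v]≡u-v w u v)
    where ring : ∀ z x y → (z + x) - (z + y) ≡ x - y
          ring = solve-∀

  [u-v]-w≡u-[v+w] : (u v w : Vec ℤ n) → (u -ᵥ v) -ᵥ w ≡ u -ᵥ (v +ᵥ w)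
  [u-v]-w≡u-[v+w] []      []      []      = refl
  [u-v]-w≡u-[v+w] (x ∷ u) (y ∷ v) (z ∷ w) = cong₂ _∷_ (ring x y z) ([u-v]-w≡u-[v+w] u v w)
    where ring : ∀ x y z → (x - y) - z ≡ x - (y + z)
          ring = solve-∀

  +ᵥ-interchange : (u v w z : Vec ℤ n) → (u +ᵥ v) +ᵥ (w +ᵥ z) ≡ (u +ᵥ w) +ᵥ (v +ᵥ z)
  +ᵥ-interchange []      []      []      []      = refl
  +ᵥ-interchange (a ∷ u) (b ∷ v) (c ∷ w) (d ∷ z) = cong₂ _∷_ (ring a b c d) (+ᵥ-interchange u v w z)
    where ring : ∀ a b c d → (a + b) + (c + d) ≡ (a + c) + (b + d)
          ring = solve-∀

  ·ᵥ-distribˡ-−ᵥ : ∀ a (u v : Vec ℤ n) → a ·ᵥ (u -ᵥ v) ≡ (a ·ᵥ u) -ᵥ (a ·ᵥ v)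
  ·ᵥ-distribˡ-−ᵥ a []      []      = refl
  ·ᵥ-distribˡ-−ᵥ a (x ∷ u) (y ∷ v) = cong₂ _∷_ (ring a x y) (·ᵥ-distribˡ-−ᵥ a u v)
    where ring : ∀ a x y → a * (x - y) ≡ a * x - a * y
          ring = solve-∀

  u+[-1]v≡u-v : (u v : Vec ℤ n) → u +ᵥ (-[1+ 0 ] ·ᵥ v) ≡ u -ᵥ v
  u+[-1]v≡u-v []      []      = refl
  u+[-1]v≡u-v (x ∷ u) (y ∷ v) = cong₂ _∷_ (cong (_+_ x) (ℤ.-1*i≡-i y)) (u+[-1]v≡u-v u v)

  ·ᵥ-identityˡ : (v : Vec ℤ n) → (+ 1) ·ᵥ v ≡ v
  ·ᵥ-identityˡ []      = refl
  ·ᵥ-identityˡ (x ∷ v) = cong₂ _∷_ (ℤ.*-identityˡ x) (·ᵥ-identityˡ v)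

  ·ᵥ-zeroˡ : (v : Vec ℤ n) → (+ 0) ·ᵥ v ≡ 0ᵥ
  ·ᵥ-zeroˡ []      = refl
  ·ᵥ-zeroˡ (x ∷ v) = cong (+ 0 ∷_) (·ᵥ-zeroˡ v)

  ·ᵥ-zeroʳ : ∀ a → a ·ᵥ 0ᵥ {n} ≡ 0ᵥ
  ·ᵥ-zeroʳ {zero}  a = refl
  ·ᵥ-zeroʳ {suc n} a = cong₂ _∷_ (ℤ.*-zeroʳ a) (·ᵥ-zeroʳ a)

  ·ᵥ-assoc : ∀ a b (v : Vec ℤ n) → a ·ᵥ (b ·ᵥ v) ≡ (a * b) ·ᵥ v
  ·ᵥ-assoc a b []      = refl
  ·ᵥ-assoc a b (x ∷ v) = cong₂ _∷_ (sym (ℤ.*-assoc a b x)) (·ᵥ-assoc a b v)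

  ·ᵥ-comm : ∀ a b (v : Vec ℤ n) → a ·ᵥ (b ·ᵥ v) ≡ b ·ᵥ (a ·ᵥ v)
  ·ᵥ-comm a b v = trans (·ᵥ-assoc a b v) (trans (cong (_·ᵥ v) (ℤ.*-comm a b)) (sym (·ᵥ-assoc b a v)))

  ·ᵥ-distribˡ-+ᵥ : ∀ a (u v : Vec ℤ n) → a ·ᵥ (u +ᵥ v) ≡ (a ·ᵥ u) +ᵥ (a ·ᵥ v)
  ·ᵥ-distribˡ-+ᵥ a []      []      = refl
  ·ᵥ-distribˡ-+ᵥ a (x ∷ u) (y ∷ v) = cong₂ _∷_ (ℤ.*-distribˡ-+ a x y) (·ᵥ-distribˡ-+ᵥ a u v)

  ·ᵥ-distribʳ-+ : ∀ a b (v : Vec ℤ n) → (a + b) ·ᵥ v ≡ (a ·ᵥ v) +ᵥ (b ·ᵥ v)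
  ·ᵥ-distribʳ-+ a b []      = refl
  ·ᵥ-distribʳ-+ a b (x ∷ v) = cong₂ _∷_ (ℤ.*-distribʳ-+ x a b) (·ᵥ-distribʳ-+ a b v)

  ·ᵥ-cancelˡ : ∀ a {u v : Vec ℤ n} → a ≢ + 0 → a ·ᵥ u ≡ a ·ᵥ v → u ≡ v
  ·ᵥ-cancelˡ a {[]}    {[]}    a≢0 _  = refl
  ·ᵥ-cancelˡ a {x ∷ u} {y ∷ v} a≢0 eq = cong₂ _∷_
    (ℤ.*-cancelˡ-≡ a x y {{ℤ.≢-nonZero a≢0}} (cong head eq)) (·ᵥ-cancelˡ a a≢0 (cong tail eq))

  *-≢0 : ∀ {a b : ℤ} → a ≢ + 0 → b ≢ + 0 → a * b ≢ + 0
  *-≢0 {a} a≢0 b≢0 ab≡0 = [ a≢0 , b≢0 ]′ (ℤ.i*j≡0⇒i≡0∨j≡0 a ab≡0)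

  SupportedOn-tail : ∀ {s} {S : Subset k} {c : Fin (suc k) → ℤ} →
    SupportedOn (s ∷ S) c → SupportedOn S (c ∘ suc)
  SupportedOn-tail supp i i∉S = supp (suc i) λ { (there i∈S) → i∉S i∈S }

  comb-cong : (X : Config n k) {c d : Fin k → ℤ} → (∀ i → c i ≡ d i) → comb X c ≡ comb X d
  comb-cong []      _   = refl
  comb-cong (x ∷ X) c≗d = cong₂ (λ a v → (a ·ᵥ x) +ᵥ v) (c≗d zero) (comb-cong X (c≗d ∘ suc))

  comb-0 : (X : Config n k) → comb X (λ _ → + 0) ≡ 0ᵥ
  comb-0 []      = refl
  comb-0 (x ∷ X) = trans (cong₂ _+ᵥ_ (·ᵥ-zeroˡ x) (comb-0 X)) (+ᵥ-identityˡ 0ᵥ)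

  comb-+ : (X : Config n k) (c d : Fin k → ℤ) → comb X (λ i → c i + d i) ≡ comb X c +ᵥ comb X d
  comb-+ []      c d = sym (+ᵥ-identityˡ 0ᵥ)
  comb-+ (x ∷ X) c d = begin
    ((c zero + d zero) ·ᵥ x) +ᵥ comb X (λ i → c (suc i) + d (suc i))
      ≡⟨ cong₂ _+ᵥ_ (·ᵥ-distribʳ-+ (c zero) (d zero) x) (comb-+ X (c ∘ suc) (d ∘ suc)) ⟩
    ((c zero ·ᵥ x) +ᵥ (d zero ·ᵥ x)) +ᵥ (comb X (c ∘ suc) +ᵥ comb X (d ∘ suc))
      ≡⟨ +ᵥ-interchange _ _ _ _ ⟩
    comb (x ∷ X) c +ᵥ comb (x ∷ X) d ∎
    where open ≡-Reasoning

  comb-· : (X : Config n k) (a : ℤ) (c : Fin k → ℤ) → comb X (λ i → a * c i) ≡ a ·ᵥ comb X c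
  comb-· []      a c = sym (·ᵥ-zeroʳ a)
  comb-· (x ∷ X) a c = begin
    ((a * c zero) ·ᵥ x) +ᵥ comb X (λ i → a * c (suc i))
      ≡⟨ cong₂ _+ᵥ_ (sym (·ᵥ-assoc a (c zero) x)) (comb-· X a (c ∘ suc)) ⟩
    (a ·ᵥ (c zero ·ᵥ x)) +ᵥ (a ·ᵥ comb X (c ∘ suc))
      ≡⟨ sym (·ᵥ-distribˡ-+ᵥ a _ _) ⟩
    a ·ᵥ comb (x ∷ X) c ∎
    where open ≡-Reasoning

  comb-− : (X : Config n k) (c d : Fin k → ℤ) → comb X (λ i → c i - d i) ≡ comb X c -ᵥ comb X d
  comb-− X c d = begin
    comb X (λ i → c i - d i)
      ≡⟨ comb-cong X (λ i → cong (_+_ (c i)) (sym (ℤ.-1*i≡-i (d i)))) ⟩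
    comb X (λ i → c i + -[1+ 0 ] * d i)           ≡⟨ comb-+ X c _ ⟩
    comb X c +ᵥ comb X (λ i → -[1+ 0 ] * d i)     ≡⟨ cong (comb X c +ᵥ_) (comb-· X -[1+ 0 ] d) ⟩
    comb X c +ᵥ (-[1+ 0 ] ·ᵥ comb X d)            ≡⟨ u+[-1]v≡u-v _ _ ⟩
    comb X c -ᵥ comb X d ∎
    where open ≡-Reasoning

  δ : Fin k → Fin k → ℤ
  δ zero    zero    = + 1
  δ zero    (suc _) = + 0
  δ (suc _) zero    = + 0
  δ (suc p) (suc i) = δ p i

  δ-diag : (p : Fin k) → δ p p ≡ + 1
  δ-diag zero    = refl
  δ-diag (suc p) = δ-diag p

  δ-offdiag : (p i : Fin k) → i ≢ p → δ p i ≡ + 0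
  δ-offdiag zero    zero    i≢p = ⊥-elim (i≢p refl)
  δ-offdiag zero    (suc i) _   = refl
  δ-offdiag (suc p) zero    _   = refl
  δ-offdiag (suc p) (suc i) i≢p = δ-offdiag p i (i≢p ∘ cong suc)

  δ-supported : ∀ {S : Subset k} {p} → p ∈ S → SupportedOn S (δ p)
  δ-supported {p = p} p∈S i i∉S = δ-offdiag p i λ { refl → i∉S p∈S }

  comb-δ : (X : Config n k) (p : Fin k) → comb X (δ p) ≡ lookup X p
  comb-δ (x ∷ X) zero    = trans (cong₂ _+ᵥ_ (·ᵥ-identityˡ x) (comb-0 X)) (+ᵥ-identityʳ x)
  comb-δ (x ∷ X) (suc p) = trans (cong₂ _+ᵥ_ (·ᵥ-zeroˡ x) (comb-δ X p)) (+ᵥ-identityˡ _)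

  record IsLinear (φ : Vec ℤ m → Vec ℤ n) : Set where
    field
      homo-+ᵥ : ∀ u v → φ (u +ᵥ v) ≡ φ u +ᵥ φ v
      homo-·ᵥ : ∀ a v → φ (a ·ᵥ v) ≡ a ·ᵥ φ v

    homo-0ᵥ : φ 0ᵥ ≡ 0ᵥ
    homo-0ᵥ = begin
      φ 0ᵥ             ≡⟨ cong φ (sym (·ᵥ-zeroˡ 0ᵥ)) ⟩
      φ ((+ 0) ·ᵥ 0ᵥ)    ≡⟨ homo-·ᵥ (+ 0) 0ᵥ ⟩
      (+ 0) ·ᵥ φ 0ᵥ      ≡⟨ ·ᵥ-zeroˡ _ ⟩
      0ᵥ ∎
      where open ≡-Reasoning

    homo-−ᵥ : ∀ u v → φ (u -ᵥ v) ≡ φ u -ᵥ φ v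
    homo-−ᵥ u v = begin
      φ (u -ᵥ v)                          ≡⟨ cong φ (sym (u+[-1]v≡u-v u v)) ⟩
      φ (u +ᵥ (-[1+ 0 ] ·ᵥ v))            ≡⟨ homo-+ᵥ u _ ⟩
      φ u +ᵥ φ (-[1+ 0 ] ·ᵥ v)            ≡⟨ cong (φ u +ᵥ_) (homo-·ᵥ -[1+ 0 ] v) ⟩
      φ u +ᵥ (-[1+ 0 ] ·ᵥ φ v)            ≡⟨ u+[-1]v≡u-v _ _ ⟩
      φ u -ᵥ φ v ∎
      where open ≡-Reasoning

  comb-map : ∀ {φ : Vec ℤ m → Vec ℤ n} → IsLinear φ →
    (X : Config m k) (c : Fin k → ℤ) → comb (map φ X) c ≡ φ (comb X c)
  comb-map φ-lin []      c = sym (IsLinear.homo-0ᵥ φ-lin)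
  comb-map {φ = φ} φ-lin (x ∷ X) c = begin
    (c zero ·ᵥ φ x) +ᵥ comb (map φ X) (c ∘ suc)
      ≡⟨ cong₂ _+ᵥ_ (sym (homo-·ᵥ (c zero) x)) (comb-map φ-lin X (c ∘ suc)) ⟩
    φ (c zero ·ᵥ x) +ᵥ φ (comb X (c ∘ suc))
      ≡⟨ sym (homo-+ᵥ _ _) ⟩
    φ (comb (x ∷ X) c) ∎
    where
      open ≡-Reasoning
      open IsLinear φ-lin

  ·ᵥ-isLinear : (a : ℤ) → IsLinear {n} (a ·ᵥ_)
  ·ᵥ-isLinear a = record { homo-+ᵥ = ·ᵥ-distribˡ-+ᵥ a ; homo-·ᵥ = λ b v → ·ᵥ-comm a b v }

  tail-isLinear : IsLinear {suc n} tail
  tail-isLinear = record { homo-+ᵥ = λ { (_ ∷ _) (_ ∷ _) → refl } ; homo-·ᵥ = λ { _ (_ ∷ _) → refl } }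

  -- Subgroups of ℤⁿ and their indices

  record IsSubgroup (H : Pred (Vec ℤ n) 0ℓ) : Set where
    field
      ∈-0ᵥ  : H 0ᵥ
      ∈-−ᵥ  : ∀ {u v} → H u → H v → H (u -ᵥ v)

    ∈-+ᵥ : ∀ {u v} → H u → H v → H (u +ᵥ v)
    ∈-+ᵥ {u} {v} u∈H v∈H = subst H (sym (u+v≡u-[0-v] u v)) (∈-−ᵥ u∈H (∈-−ᵥ ∈-0ᵥ v∈H))

  record IsSubmodule (H : Pred (Vec ℤ n) 0ℓ) : Set where
    field
      isSubgroup : IsSubgroup H
      ∈-·ᵥ       : ∀ a {v} → H v → H (a ·ᵥ v)

    open IsSubgroup isSubgroup public

  comb-∈ : ∀ {P : Pred (Vec ℤ n) 0ℓ} → IsSubmodule P → (X : Config n k) {S : Subset k} →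
    (∀ i → i ∈ S → P (lookup X i)) → ∀ {c} → SupportedOn S c → P (comb X c)
  comb-∈ P-sub []      _      _    = IsSubmodule.∈-0ᵥ P-sub
  comb-∈ {P = P} P-sub (x ∷ X) {s ∷ S} S⊆P {c} supp =
    ∈-+ᵥ (head∈P (S⊆P zero) supp) (comb-∈ P-sub X (λ i i∈S → S⊆P (suc i) (there i∈S)) (SupportedOn-tail supp))
    where
      open IsSubmodule P-sub
      head∈P : ∀ {s} → (zero ∈ s ∷ S → P x) → SupportedOn (s ∷ S) c → P (c zero ·ᵥ x)
      head∈P {inside}  x∈P _    = ∈-·ᵥ (c zero) (x∈P here)
      head∈P {outside} _   supp = subst P (sym (trans (cong (_·ᵥ x) (supp zero λ ())) (·ᵥ-zeroˡ x))) ∈-0ᵥ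

  module _ (X : Config n k) (S : Subset k) where

    InZSpan-isSubmodule : IsSubmodule (InZSpan X S)
    InZSpan-isSubmodule = record
      { isSubgroup = record
        { ∈-0ᵥ = (λ _ → + 0) , (λ _ _ → refl) , comb-0 X
        ; ∈-−ᵥ = λ { (c , c-supp , refl) (d , d-supp , refl) →
            (λ i → c i - d i) , (λ i i∉S → cong₂ _-_ (c-supp i i∉S) (d-supp i i∉S)) , comb-− X c d }
        }
      ; ∈-·ᵥ = λ { a (c , c-supp , refl) →
          (λ i → a * c i) , (λ i i∉S → trans (cong (a *_) (c-supp i i∉S)) (ℤ.*-zeroʳ a)) , comb-· X a c }
      }

    InZSpan⊆InΛ : InZSpan X S ⊆ₚ InΛ X S
    InZSpan⊆InΛ {v} v∈Z = + 1 , (λ ()) , subst (InZSpan X S) (sym (·ᵥ-identityˡ v)) v∈Z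

    InΛ-saturated : ∀ {d v} → d ≢ + 0 → InΛ X S (d ·ᵥ v) → InΛ X S v
    InΛ-saturated {d} {v} d≢0 (e , e≢0 , edv∈Z) =
      e * d , *-≢0 e≢0 d≢0 , subst (InZSpan X S) (·ᵥ-assoc e d v) edv∈Z

    InΛ-isSubmodule : IsSubmodule (InΛ X S)
    InΛ-isSubmodule = record
      { isSubgroup = record
        { ∈-0ᵥ = InZSpan⊆InΛ Z.∈-0ᵥ
        ; ∈-−ᵥ = λ { {u} {v} (d , d≢0 , du∈Z) (e , e≢0 , ev∈Z) →
            d * e , *-≢0 d≢0 e≢0 ,
            subst (InZSpan X S) (sym (clear-denominators d e u v)) (Z.∈-−ᵥ (Z.∈-·ᵥ e du∈Z) (Z.∈-·ᵥ d ev∈Z)) }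
        }
      ; ∈-·ᵥ = λ { a {v} (d , d≢0 , dv∈Z) → d , d≢0 , subst (InZSpan X S) (·ᵥ-comm a d v) (Z.∈-·ᵥ a dv∈Z) }
      }
      where
        module Z = IsSubmodule InZSpan-isSubmodule
        clear-denominators : ∀ d e (u v : Vec ℤ n) →
          (d * e) ·ᵥ (u -ᵥ v) ≡ (e ·ᵥ (d ·ᵥ u)) -ᵥ (d ·ᵥ (e ·ᵥ v))
        clear-denominators d e u v = trans (·ᵥ-distribˡ-−ᵥ (d * e) u v)
          (cong₂ _-ᵥ_ (trans (sym (·ᵥ-assoc d e u)) (·ᵥ-comm d e u)) (sym (·ᵥ-assoc d e v)))

    lookup∈InZSpan : ∀ {i} → i ∈ S → InZSpan X S (lookup X i)
    lookup∈InZSpan {i} i∈S = δ i , δ-supported i∈S , comb-δ X i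

  module _ (X : Config n k) {S S′ : Subset k} (S⊆S′ : S ⊆ S′) where

    InZSpan-mono : InZSpan X S ⊆ₚ InZSpan X S′
    InZSpan-mono (c , c-supp , c-comb) = c , (λ i i∉S′ → c-supp i (i∉S′ ∘ S⊆S′)) , c-comb

    InΛ-mono : InΛ X S ⊆ₚ InΛ X S′
    InΛ-mono (d , d≢0 , dv∈Z) = d , d≢0 , InZSpan-mono dv∈Z

  _∼[_]_ : Vec ℤ n → Pred (Vec ℤ n) 0ℓ → Vec ℤ n → Set
  u ∼[ H ] v = H (u -ᵥ v)

  module Cosets {H : Pred (Vec ℤ n) 0ℓ} (H-sub : IsSubgroup H) where
    open IsSubgroup H-sub

    ∼-sym : ∀ {u v} → u ∼[ H ] v → v ∼[ H ] u
    ∼-sym {u} {v} u∼v = subst H (0-[u-v]≡v-u u v) (∈-−ᵥ ∈-0ᵥ u∼v)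

    ∼-trans : ∀ {u v w} → u ∼[ H ] v → v ∼[ H ] w → u ∼[ H ] w
    ∼-trans {u} {v} {w} u∼v v∼w = subst H ([u-w]-[v-w]≡u-v u w v) (∈-−ᵥ u∼v (∼-sym v∼w))

    ∈⇒∼0 : ∀ {v} → H v → v ∼[ H ] 0ᵥ
    ∈⇒∼0 {v} = subst H (sym (v-0≡v v))

    ∼0⇒∈ : ∀ {v} → v ∼[ H ] 0ᵥ → H v
    ∼0⇒∈ {v} = subst H (v-0≡v v)

    +-∼ : ∀ {v w} → H w → (v +ᵥ w) ∼[ H ] v
    +-∼ {v} {w} = subst H (sym ([u+v]-u≡v v w))

  -- `IsIndex X S m` unfolds to `Index (InΛ X S) (InZSpan X S) m`.
  Index : (G H : Pred (Vec ℤ n) 0ℓ) → ℕ → Set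
  Index {n} G H m = Σ (Fin m → Vec ℤ n) λ rep →
      (∀ j → G (rep j))
    × (∀ j j′ → rep j ∼[ H ] rep j′ → j ≡ j′)
    × (∀ v → G v → ∃ λ j → v ∼[ H ] rep j)

  module _ {G H : Pred (Vec ℤ n) 0ℓ} where

    Index-congˡ : ∀ {G′ m} → G ⊆ₚ G′ → G′ ⊆ₚ G → Index G H m → Index G′ H m
    Index-congˡ G⊆G′ G′⊆G (rep , rep∈G , irredundant , complete) =
      rep , G⊆G′ ∘ rep∈G , irredundant , λ v → complete v ∘ G′⊆G

    Index-≤ : ∀ {a b} → IsSubgroup H → Index G H a → Index G H b → a ≤ b
    Index-≤ H-sub (ρ , ρ∈G , ρ-irredundant , _) (σ , _ , _ , σ-complete) = Fin.injective⇒≤ f-injective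
      where
        open Cosets H-sub
        f : Fin _ → Fin _
        f i = proj₁ (σ-complete (ρ i) (ρ∈G i))
        ρ∼σf : ∀ i → ρ i ∼[ H ] σ (f i)
        ρ∼σf i = proj₂ (σ-complete (ρ i) (ρ∈G i))
        f-injective : ∀ {i i′} → f i ≡ f i′ → i ≡ i′
        f-injective {i} {i′} eq =
          ρ-irredundant i i′ (∼-trans (ρ∼σf i) (∼-sym (subst (λ j → ρ i′ ∼[ H ] σ j) (sym eq) (ρ∼σf i′))))

    Index-unique : ∀ {a b} → IsSubgroup H → Index G H a → Index G H b → a ≡ b
    Index-unique H-sub I J = ℕₚ.≤-antisym (Index-≤ H-sub I J) (Index-≤ H-sub J I)

  fiber : ∀ {a b} (f : Fin a → Fin b) (j : Fin b) → ∃[ c ] Σ (Fin c → Fin a) λ g →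
    (∀ {l l′} → g l ≡ g l′ → l ≡ l′) × (∀ l → f (g l) ≡ j) × (∀ i → f i ≡ j → ∃ λ l → g l ≡ i)
  fiber {zero}  f j = 0 , (λ ()) , (λ {}) , (λ ()) , (λ ())
  fiber {suc a} f j with fiber (f ∘ suc) j | f zero Fin.≟ j
  ... | c , g , g-inj , g-in , g-onto | yes fzero≡j = suc c , g′ , g′-inj , g′-in , g′-onto
    where
      g′ : Fin (suc c) → Fin (suc a)
      g′ zero    = zero
      g′ (suc l) = suc (g l)
      g′-inj : ∀ {l l′} → g′ l ≡ g′ l′ → l ≡ l′
      g′-inj {zero}  {zero}   _  = refl
      g′-inj {suc l} {suc l′} eq = cong suc (g-inj (Fin.suc-injective eq))
      g′-in : ∀ l → f (g′ l) ≡ j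
      g′-in zero    = fzero≡j
      g′-in (suc l) = g-in l
      g′-onto : ∀ i → f i ≡ j → ∃ λ l → g′ l ≡ i
      g′-onto zero    _   = zero , refl
      g′-onto (suc i) fi≡j = let l , gl≡i = g-onto i fi≡j in suc l , cong suc gl≡i
  ... | c , g , g-inj , g-in , g-onto | no fzero≢j =
    c , suc ∘ g , g-inj ∘ Fin.suc-injective , g-in , g′-onto
    where
      g′-onto : ∀ i → f i ≡ j → ∃ λ l → suc (g l) ≡ i
      g′-onto zero    fzero≡j = ⊥-elim (fzero≢j fzero≡j)
      g′-onto (suc i) fi≡j    = let l , gl≡i = g-onto i fi≡j in l , cong suc gl≡i

  module _ {G H K : Pred (Vec ℤ n) 0ℓ} (G-sub : IsSubgroup G) (H-sub : IsSubgroup H)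
           (H⊆G : H ⊆ₚ G) (K⊆H : K ⊆ₚ H) where

    open Cosets H-sub

    Index-* : ∀ {b c} → Index G H b → Index H K c → Index G K (b ℕ.* c)
    Index-* {b} {c} (σ , σ∈G , σ-irredundant , σ-complete) (τ , τ∈H , τ-irredundant , τ-complete) =
      rep , rep∈G , irredundant , complete
      where
        rep : Fin (b ℕ.* c) → Vec ℤ n
        rep x = σ (proj₁ (remQuot {b} c x)) +ᵥ τ (proj₂ (remQuot {b} c x))

        rep∈G : ∀ x → G (rep x)
        rep∈G x = IsSubgroup.∈-+ᵥ G-sub (σ∈G _) (H⊆G (τ∈H _))

        irredundant : ∀ x x′ → rep x ∼[ K ] rep x′ → x ≡ x′
        irredundant x x′ rep∼rep′ = begin
          x                          ≡⟨ Fin.combine-remQuot {b} c x ⟨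
          combine j l                ≡⟨ cong₂ combine j≡j′ l≡l′ ⟩
          combine j′ l′              ≡⟨ Fin.combine-remQuot {b} c x′ ⟩
          x′ ∎
          where
            open ≡-Reasoning
            j = proj₁ (remQuot {b} c x)
            l = proj₂ (remQuot {b} c x)
            j′ = proj₁ (remQuot {b} c x′)
            l′ = proj₂ (remQuot {b} c x′)
            j≡j′ : j ≡ j′
            j≡j′ = σ-irredundant j j′
              (∼-trans (∼-sym (+-∼ (τ∈H l))) (∼-trans (K⊆H rep∼rep′) (+-∼ (τ∈H l′))))
            l≡l′ : l ≡ l′
            l≡l′ = τ-irredundant l l′ (subst K ([w+u]-[w+v]≡u-v (σ j) (τ l) (τ l′))
              (subst (λ j″ → rep x ∼[ K ] (σ j″ +ᵥ τ l′)) (sym j≡j′) rep∼rep′))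

        complete : ∀ v → G v → ∃ λ x → v ∼[ K ] rep x
        complete v v∈G = combine j l ,
          subst (λ jl → v ∼[ K ] (σ (proj₁ jl) +ᵥ τ (proj₂ jl))) (sym (Fin.remQuot-combine {b} {c} j l))
            (subst K ([u-v]-w≡u-[v+w] v (σ j) (τ l)) v-σj∼τl)
          where
            j = proj₁ (σ-complete v v∈G)
            l = proj₁ (τ-complete (v -ᵥ σ j) (proj₂ (σ-complete v v∈G)))
            v-σj∼τl = proj₂ (τ-complete (v -ᵥ σ j) (proj₂ (σ-complete v v∈G)))

    -- The representatives of G/K lying in the coset H of 0 represent H/K.
    Index-intermediate : ∀ {a b} → Index G K a → Index G H b → ∃ λ c → Index H K c
    Index-intermediate (ρ , ρ∈G , ρ-irredundant , ρ-complete) (σ , _ , σ-irredundant , σ-complete) =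
      c , ρ ∘ g , rep∈H , (λ l l′ → g-inj ∘ ρ-irredundant (g l) (g l′)) , complete
      where
        coset : ∀ i → ∃ λ j → ρ i ∼[ H ] σ j
        coset i = σ-complete (ρ i) (ρ∈G i)
        j₀ = proj₁ (σ-complete 0ᵥ (IsSubgroup.∈-0ᵥ G-sub))
        0∼σj₀ = proj₂ (σ-complete 0ᵥ (IsSubgroup.∈-0ᵥ G-sub))
        preimage = fiber (proj₁ ∘ coset) j₀
        c = proj₁ preimage
        g = proj₁ (proj₂ preimage)
        g-inj = proj₁ (proj₂ (proj₂ preimage))
        g-in = proj₁ (proj₂ (proj₂ (proj₂ preimage)))
        g-onto = proj₂ (proj₂ (proj₂ (proj₂ preimage)))

        rep∈H : ∀ l → H (ρ (g l))
        rep∈H l = ∼0⇒∈ (∼-trans (subst (λ j → ρ (g l) ∼[ H ] σ j) (g-in l) (proj₂ (coset (g l))))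
                                (∼-sym 0∼σj₀))

        complete : ∀ h → H h → ∃ λ l → h ∼[ K ] ρ (g l)
        complete h h∈H = l , subst (λ i′ → h ∼[ K ] ρ i′) (sym gl≡i) h∼ρi
          where
            i = proj₁ (ρ-complete h (H⊆G h∈H))
            h∼ρi = proj₂ (ρ-complete h (H⊆G h∈H))
            ρi∼0 : ρ i ∼[ H ] 0ᵥ
            ρi∼0 = ∼-trans (∼-sym (K⊆H h∼ρi)) (∈⇒∼0 h∈H)
            coset-i≡j₀ : proj₁ (coset i) ≡ j₀
            coset-i≡j₀ = σ-irredundant _ _ (∼-trans (∼-sym (proj₂ (coset i))) (∼-trans ρi∼0 0∼σj₀))
            l = proj₁ (g-onto i coset-i≡j₀)
            gl≡i = proj₂ (g-onto i coset-i≡j₀)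

  -- Fraction-free Gaussian elimination

  Dependent : Config n k → Subset k → Set
  Dependent X T = ∃ λ c → SupportedOn T c × comb X c ≡ 0ᵥ × ∃ λ i → c i ≢ + 0

  LinIndep⇒¬Dependent : ∀ (X : Config n k) {T} → LinIndep X T → ¬ Dependent X T
  LinIndep⇒¬Dependent X indep (c , c-supp , c-comb , i , cᵢ≢0) = cᵢ≢0 (indep c c-supp c-comb i)

  -- Subset._-_ is defined through zipWith and a local helper, which blocks induction; hence _∖_.
  _∖_ : Subset k → Fin k → Subset k
  (_ ∷ T) ∖ zero  = outside ∷ T
  (s ∷ T) ∖ suc p = s ∷ (T ∖ p)

  ∖-⊆ : (T : Subset k) {p i : Fin k} → i ∈ T ∖ p → i ∈ T
  ∖-⊆ (_ ∷ T) {zero}  (there i∈) = there i∈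
  ∖-⊆ (_ ∷ T) {suc p} here       = here
  ∖-⊆ (_ ∷ T) {suc p} (there i∈) = there (∖-⊆ T i∈)

  ∈∖⇒≢ : (T : Subset k) {p i : Fin k} → i ∈ T ∖ p → i ≢ p
  ∈∖⇒≢ (_ ∷ T) {zero}  (there _)  ()
  ∈∖⇒≢ (_ ∷ T) {suc p} here       ()
  ∈∖⇒≢ (_ ∷ T) {suc p} (there i∈) refl = ∈∖⇒≢ T i∈ refl

  ∈∧≢⇒∈∖ : (T : Subset k) {p i : Fin k} → i ∈ T → i ≢ p → i ∈ T ∖ p
  ∈∧≢⇒∈∖ (_ ∷ T) {zero}  here       i≢p = ⊥-elim (i≢p refl)
  ∈∧≢⇒∈∖ (_ ∷ T) {zero}  (there i∈) _   = there i∈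
  ∈∧≢⇒∈∖ (_ ∷ T) {suc p} here       _   = here
  ∈∧≢⇒∈∖ (_ ∷ T) {suc p} (there i∈) i≢p = there (∈∧≢⇒∈∖ T i∈ (i≢p ∘ cong suc))

  ∣T∣≤1+∣T∖p∣ : (T : Subset k) (p : Fin k) → ∣ T ∣ ≤ suc ∣ T ∖ p ∣
  ∣T∣≤1+∣T∖p∣ (inside  ∷ T) zero    = ℕₚ.≤-refl
  ∣T∣≤1+∣T∖p∣ (outside ∷ T) zero    = ℕₚ.n≤1+n ∣ T ∣
  ∣T∣≤1+∣T∖p∣ (inside  ∷ T) (suc p) = s≤s (∣T∣≤1+∣T∖p∣ T p)
  ∣T∣≤1+∣T∖p∣ (outside ∷ T) (suc p) = ∣T∣≤1+∣T∖p∣ T p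

  head0-isSubmodule : IsSubmodule {suc n} (λ v → head v ≡ + 0)
  head0-isSubmodule = record
    { isSubgroup = record { ∈-0ᵥ = refl ; ∈-−ᵥ = λ { {_ ∷ _} {_ ∷ _} refl refl → refl } }
    ; ∈-·ᵥ = λ { a {_ ∷ _} refl → ℤ.*-zeroʳ a }
    }

  head-·ᵥ : ∀ a (v : Vec ℤ (suc n)) → head (a ·ᵥ v) ≡ a * head v
  head-·ᵥ a (_ ∷ _) = refl

  0ᵥ-by-head-tail : (v : Vec ℤ (suc n)) → head v ≡ + 0 → tail v ≡ 0ᵥ → v ≡ 0ᵥ
  0ᵥ-by-head-tail (_ ∷ _) refl refl = refl

  module _ (X : Config (suc n) k) {T : Subset k} (heads-0 : ∀ i → i ∈ T → head (lookup X i) ≡ + 0) where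

    Dependent-tails⇒ : Dependent (map tail X) T → Dependent X T
    Dependent-tails⇒ (c , c-supp , c-comb , nontrivial) =
      c , c-supp , 0ᵥ-by-head-tail _ (comb-∈ head0-isSubmodule X heads-0 c-supp)
                     (trans (sym (comb-map tail-isLinear X c)) c-comb) , nontrivial

    LinIndep-tails⇒ : LinIndep (map tail X) T → LinIndep X T
    LinIndep-tails⇒ indep c c-supp c-comb = indep c c-supp (trans (comb-map tail-isLinear X c) (cong tail c-comb))

  eliminate : Vec ℤ (suc n) → Vec ℤ (suc n) → Vec ℤ n
  eliminate x v = (head x ·ᵥ tail v) -ᵥ (head v ·ᵥ tail x)

  eliminate-correct : (x v : Vec ℤ (suc n)) → (head x ·ᵥ v) -ᵥ (head v ·ᵥ x) ≡ + 0 ∷ eliminate x v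
  eliminate-correct (a ∷ y) (s ∷ w) = cong (_∷ eliminate (a ∷ y) (s ∷ w)) (ring a s)
    where ring : ∀ a s → a * s - s * a ≡ + 0
          ring = solve-∀

  eliminate-self : (x : Vec ℤ (suc n)) → eliminate x x ≡ 0ᵥ
  eliminate-self (a ∷ y) = v-v≡0 (a ·ᵥ y)

  eliminate-isLinear : (x : Vec ℤ (suc n)) → IsLinear (eliminate x)
  eliminate-isLinear (a ∷ y) = record
    { homo-+ᵥ = λ { (s ∷ u) (t ∷ v) → additive s t u v y }
    ; homo-·ᵥ = λ { b (s ∷ u) → homogeneous b s u y }
    }
    where
      additive : ∀ {n} s t (u v y : Vec ℤ n) →
        (a ·ᵥ (u +ᵥ v)) -ᵥ ((s + t) ·ᵥ y) ≡ ((a ·ᵥ u) -ᵥ (s ·ᵥ y)) +ᵥ ((a ·ᵥ v) -ᵥ (t ·ᵥ y))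
      additive s t []      []      []      = refl
      additive s t (u₀ ∷ u) (v₀ ∷ v) (y₀ ∷ y) = cong₂ _∷_ (ring a s t u₀ v₀ y₀) (additive s t u v y)
        where ring : ∀ a s t u v y → a * (u + v) - (s + t) * y ≡ (a * u - s * y) + (a * v - t * y)
              ring = solve-∀
      homogeneous : ∀ {n} b s (u y : Vec ℤ n) →
        (a ·ᵥ (b ·ᵥ u)) -ᵥ ((b * s) ·ᵥ y) ≡ b ·ᵥ ((a ·ᵥ u) -ᵥ (s ·ᵥ y))
      homogeneous b s []       []       = refl
      homogeneous b s (u₀ ∷ u) (y₀ ∷ y) = cong₂ _∷_ (ring a b s u₀ y₀) (homogeneous b s u y)
        where ring : ∀ a b s u y → a * (b * u) - (b * s) * y ≡ b * (a * u - s * y)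
              ring = solve-∀

  module _ (X : Config (suc n) k) {T : Subset k} {p : Fin k} (p∈T : p ∈ T)
           (a≢0 : head (lookup X p) ≢ + 0) where

    private
      x = lookup X p
      a = head x
      Y = map (eliminate x) X

      comb-Y : ∀ c → comb Y c ≡ eliminate x (comb X c)
      comb-Y = comb-map (eliminate-isLinear x) X

      comb-Y-ignores-pivot : ∀ c → comb Y (λ i → c i - c p * δ p i) ≡ comb Y c
      comb-Y-ignores-pivot c = begin
        comb Y (λ i → c i - c p * δ p i)         ≡⟨ comb-− Y c _ ⟩
        comb Y c -ᵥ comb Y (λ i → c p * δ p i)   ≡⟨ cong (comb Y c -ᵥ_) (comb-· Y (c p) (δ p)) ⟩
        comb Y c -ᵥ (c p ·ᵥ comb Y (δ p))        ≡⟨ cong (λ v → comb Y c -ᵥ (c p ·ᵥ v)) Yₚ≡0 ⟩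
        comb Y c -ᵥ (c p ·ᵥ 0ᵥ)                  ≡⟨ cong (comb Y c -ᵥ_) (·ᵥ-zeroʳ (c p)) ⟩
        comb Y c -ᵥ 0ᵥ                           ≡⟨ v-0≡v _ ⟩
        comb Y c ∎
        where
          open ≡-Reasoning
          Yₚ≡0 : comb Y (δ p) ≡ 0ᵥ
          Yₚ≡0 = trans (comb-δ Y p) (trans (lookup-map p (eliminate x) X) (eliminate-self x))

      ∉T∖p∧≢p⇒∉T : ∀ {i} → i ∉ T ∖ p → i ≢ p → i ∉ T
      ∉T∖p∧≢p⇒∉T i∉T-p i≢p i∈T = i∉T-p (∈∧≢⇒∈∖ T i∈T i≢p)

    Dependent-eliminate⇒ : Dependent Y (T ∖ p) → Dependent X T
    Dependent-eliminate⇒ (c , c-supp , c-comb , i₀ , cᵢ₀≢0) = d , d-supp , d-comb , i₀ , dᵢ₀≢0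
      where
        s = head (comb X c)
        d : Fin k → ℤ
        d i = a * c i - s * δ p i

        i∈T-p : ∀ {i} → c i ≢ + 0 → i ∈ T ∖ p
        i∈T-p {i} cᵢ≢0 with i Subset.∈? (T ∖ p)
        ... | yes i∈ = i∈
        ... | no  i∉ = ⊥-elim (cᵢ≢0 (c-supp i i∉))

        d-supp : SupportedOn T d
        d-supp i i∉T = trans (cong₂ (λ u v → a * u - s * v)
            (c-supp i (i∉T ∘ ∖-⊆ T)) (δ-offdiag p i λ { refl → i∉T p∈T }))
          (ring a s)
          where ring : ∀ a s → a * + 0 - s * + 0 ≡ + 0
                ring = solve-∀

        d-comb : comb X d ≡ 0ᵥ
        d-comb = begin
          comb X d                                            ≡⟨ comb-− X _ _ ⟩
          comb X (λ i → a * c i) -ᵥ comb X (λ i → s * δ p i)  ≡⟨ cong₂ _-ᵥ_ (comb-· X a c) (comb-· X s (δ p)) ⟩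
          (a ·ᵥ comb X c) -ᵥ (s ·ᵥ comb X (δ p))
            ≡⟨ cong (λ v → (a ·ᵥ comb X c) -ᵥ (s ·ᵥ v)) (comb-δ X p) ⟩
          (a ·ᵥ comb X c) -ᵥ (s ·ᵥ x)                 ≡⟨ eliminate-correct x (comb X c) ⟩
          + 0 ∷ eliminate x (comb X c)                ≡⟨ cong (+ 0 ∷_) (trans (sym (comb-Y c)) c-comb) ⟩
          0ᵥ ∎
          where open ≡-Reasoning

        dᵢ₀≢0 : d i₀ ≢ + 0
        dᵢ₀≢0 dᵢ₀≡0 = *-≢0 a≢0 cᵢ₀≢0 (begin
          a * c i₀                  ≡⟨ ring (a * c i₀) s ⟨
          a * c i₀ - s * + 0
            ≡⟨ cong (λ z → a * c i₀ - s * z) (δ-offdiag p i₀ (∈∖⇒≢ T (i∈T-p cᵢ₀≢0))) ⟨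
          d i₀                      ≡⟨ dᵢ₀≡0 ⟩
          + 0 ∎)
          where
            open ≡-Reasoning
            ring : ∀ u s → u - s * + 0 ≡ u
            ring = solve-∀

    LinIndep-eliminate⇒ : LinIndep Y (T ∖ p) → LinIndep X T
    LinIndep-eliminate⇒ indep c c-supp c-comb = c≡0
      where
        e : Fin k → ℤ
        e i = c i - c p * δ p i

        e-supp : SupportedOn (T ∖ p) e
        e-supp i i∉T-p with i Fin.≟ p
        ... | yes refl = trans (cong (λ z → c i - c i * z) (δ-diag i)) (ring (c i))
          where ring : ∀ u → u - u * + 1 ≡ + 0
                ring = solve-∀
        ... | no  i≢p  = trans (cong₂ (λ u v → u - c p * v)
                                      (c-supp i (∉T∖p∧≢p⇒∉T i∉T-p i≢p)) (δ-offdiag p i i≢p))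
                               (ring (c p))
          where ring : ∀ u → + 0 - u * + 0 ≡ + 0
                ring = solve-∀

        e-comb : comb Y e ≡ 0ᵥ
        e-comb = trans (comb-Y-ignores-pivot c)
          (trans (comb-Y c) (trans (cong (eliminate x) c-comb) (IsLinear.homo-0ᵥ (eliminate-isLinear x))))

        e≡0 : ∀ i → e i ≡ + 0
        e≡0 = indep e e-supp e-comb

        c≡cₚδₚ : ∀ i → c i ≡ c p * δ p i
        c≡cₚδₚ i = ℤ.i-j≡0⇒i≡j (c i) _ (e≡0 i)

        cₚx≡0 : c p ·ᵥ x ≡ 0ᵥ
        cₚx≡0 = begin
          c p ·ᵥ x                           ≡⟨ cong (c p ·ᵥ_) (comb-δ X p) ⟨
          c p ·ᵥ comb X (δ p)                ≡⟨ comb-· X (c p) (δ p) ⟨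
          comb X (λ i → c p * δ p i)         ≡⟨ comb-cong X c≡cₚδₚ ⟨
          comb X c                           ≡⟨ c-comb ⟩
          0ᵥ ∎
          where open ≡-Reasoning

        cₚ≡0 : c p ≡ + 0
        cₚ≡0 = [ (λ cₚ≡0 → cₚ≡0) , ⊥-elim ∘ a≢0 ]′
          (ℤ.i*j≡0⇒i≡0∨j≡0 (c p) (trans (sym (head-·ᵥ (c p) x)) (cong head cₚx≡0)))

        c≡0 : ∀ i → c i ≡ + 0
        c≡0 i = trans (c≡cₚδₚ i) (cong (_* δ p i) cₚ≡0)

  dependent-or-independent : (X : Config n k) (T : Subset k) → Dependent X T ⊎ (LinIndep X T × ∣ T ∣ ≤ n)
  dependent-or-independent {zero} {k} X T with Subset.nonempty? T
  ... | yes (i , i∈T) =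
    inj₁ (δ i , δ-supported i∈T , vec0 (comb X (δ i)) , i , λ δᵢᵢ≡0 → 1≢0 (trans (sym (δ-diag i)) δᵢᵢ≡0))
    where
      vec0 : (v : Vec ℤ 0) → v ≡ 0ᵥ
      vec0 [] = refl
      1≢0 : + 1 ≢ + 0
      1≢0 ()
  ... | no  T-empty = inj₂ ((λ c c-supp _ i → c-supp i λ i∈T → T-empty (i , i∈T)) ,
                          ℕₚ.≤-reflexive (trans (cong ∣_∣ (Subset.Empty-unique T-empty)) (Subset.∣⊥∣≡0 k)))
  dependent-or-independent {suc n} X T
    with Fin.any? (λ i → (i Subset.∈? T) ×-dec ¬? (head (lookup X i) ℤ.≟ + 0))
  ... | yes (p , p∈T , a≢0) =
    Sum.map (Dependent-eliminate⇒ X p∈T a≢0)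
            (Product.map (LinIndep-eliminate⇒ X p∈T a≢0) (ℕₚ.≤-trans (∣T∣≤1+∣T∖p∣ T p) ∘ s≤s))
            (dependent-or-independent (map (eliminate (lookup X p)) X) (T ∖ p))
  ... | no  no-pivot =
    Sum.map (Dependent-tails⇒ X heads-0) (Product.map (LinIndep-tails⇒ X heads-0) ℕₚ.m≤n⇒m≤1+n)
            (dependent-or-independent (map tail X) T)
    where
      heads-0 : ∀ i → i ∈ T → head (lookup X i) ≡ + 0
      heads-0 i i∈T = decidable-stable (head (lookup X i) ℤ.≟ + 0) (λ xᵢ₀≢0 → no-pivot (i , i∈T , xᵢ₀≢0))

  LinIndep⇒∣T∣≤n : ∀ (X : Config n k) {T} → LinIndep X T → ∣ T ∣ ≤ n
  LinIndep⇒∣T∣≤n X {T} indep =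
    [ ⊥-elim ∘ LinIndep⇒¬Dependent X indep , proj₂ ]′ (dependent-or-independent X T)

  rank≤n : ∀ (X : Config n k) {A r} → IsRank X A r → r ≤ n
  rank≤n X ((T , _ , indep , refl) , _) = LinIndep⇒∣T∣≤n X indep

  module _ (X : Config n k) {A T : Subset k} (T⊆A : T ⊆ A) (indep : LinIndep X T)
           (maximal : ∀ T′ → T′ ⊆ A → LinIndep X T′ → ∣ T′ ∣ ≤ ∣ T ∣) where

    private
      ∪⁻ : ∀ {a i} → i ∈ ⁅ a ⁆ ∪ T → i ≡ a ⊎ i ∈ T
      ∪⁻ {a} i∈ = Sum.map₁ (Subset.x∈⁅y⁆⇒x≡y a) (Subset.x∈p∪q⁻ ⁅ a ⁆ T i∈)

    lookup∈InΛ-basis : ∀ {a} → a ∈ A → InΛ X T (lookup X a)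
    lookup∈InΛ-basis {a} a∈A with a Subset.∈? T
    ... | yes a∈T = InZSpan⊆InΛ X T (lookup∈InZSpan X T a∈T)
    ... | no  a∉T with dependent-or-independent X (⁅ a ⁆ ∪ T)
    ...   | inj₂ (indep′ , _) = ⊥-elim (ℕₚ.<⇒≱ (Subset.p⊂q⇒∣p∣<∣q∣ T⊂T′) (maximal _ T′⊆A indep′))
      where
        T⊂T′ : T ⊂ ⁅ a ⁆ ∪ T
        T⊂T′ = Subset.q⊆p∪q ⁅ a ⁆ T , a , Subset.p⊆p∪q T (Subset.x∈⁅x⁆ a) , a∉T
        T′⊆A : ⁅ a ⁆ ∪ T ⊆ A
        T′⊆A i∈ = [ (λ { refl → a∈A }) , T⊆A ]′ (∪⁻ i∈)
    ...   | inj₁ (c , c-supp , c-comb , i₀ , cᵢ₀≢0) with c a ℤ.≟ + 0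
    ...     | yes cₐ≡0 = ⊥-elim (cᵢ₀≢0 (indep c c-suppT c-comb i₀))
      where
        c-suppT : SupportedOn T c
        c-suppT i i∉T with i Fin.≟ a
        ... | yes refl = cₐ≡0
        ... | no  i≢a  = c-supp i ([ i≢a , i∉T ]′ ∘ ∪⁻)
    ...     | no  cₐ≢0 = c a , cₐ≢0 , e , e-supp , e-comb
      where
        e : Fin k → ℤ
        e i = c a * δ a i - c i

        e-supp : SupportedOn T e
        e-supp i i∉T with i Fin.≟ a
        ... | yes refl = trans (cong (λ z → c i * z - c i) (δ-diag i)) (ring (c i))
          where ring : ∀ u → u * + 1 - u ≡ + 0
                ring = solve-∀
        ... | no  i≢a  = trans (cong₂ (λ u v → c a * u - v)
                                      (δ-offdiag a i i≢a) (c-supp i ([ i≢a , i∉T ]′ ∘ ∪⁻)))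
                               (ring (c a))
          where ring : ∀ u → u * + 0 - + 0 ≡ + 0
                ring = solve-∀

        e-comb : comb X e ≡ c a ·ᵥ lookup X a
        e-comb = begin
          comb X e                                    ≡⟨ comb-− X _ c ⟩
          comb X (λ i → c a * δ a i) -ᵥ comb X c      ≡⟨ cong₂ _-ᵥ_ (comb-· X (c a) (δ a)) c-comb ⟩
          (c a ·ᵥ comb X (δ a)) -ᵥ 0ᵥ                 ≡⟨ v-0≡v _ ⟩
          c a ·ᵥ comb X (δ a)                         ≡⟨ cong (c a ·ᵥ_) (comb-δ X a) ⟩
          c a ·ᵥ lookup X a ∎
          where open ≡-Reasoning

    InΛ-basis : InΛ X A ⊆ₚ InΛ X T
    InΛ-basis (d , d≢0 , c , c-supp , c-comb) = InΛ-saturated X T d≢0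
      (subst (InΛ X T) c-comb (comb-∈ (InΛ-isSubmodule X T) X (λ _ → lookup∈InΛ-basis) c-supp))

  -- Scaling by q ≥ 1

  module _ (q : ℕ) .{{_ : ℕ.NonZero q}} where

    q≢0 : + q ≢ + 0
    q≢0 = ℕ.≢-nonZero⁻¹ q ∘ ℤ.+-injective

    digits-unique : ∀ {a b w} → a < q → b < q → + a - + b ≡ + q * w → a ≡ b
    digits-unique {a} {b} {w} a<q b<q a-b≡qw =
      ℤ.+-injective (ℤ.i-j≡0⇒i≡j (+ a) (+ b) (trans a-b≡qw (trans (cong (+ q *_) w≡0) (ℤ.*-zeroʳ (+ q)))))
      where
        q∣w∣<q : q ℕ.* ℤ.∣ w ∣ < q ℕ.* 1
        q∣w∣<q = begin-strict
          q ℕ.* ℤ.∣ w ∣       ≡⟨ ℤ.abs-* (+ q) w ⟨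
          ℤ.∣ + q * w ∣       ≡⟨ cong ℤ.∣_∣ a-b≡qw ⟨
          ℤ.∣ + a - + b ∣     ≡⟨ cong ℤ.∣_∣ (ℤ.m-n≡m⊖n a b) ⟩
          ℤ.∣ a ℤ.⊖ b ∣         ≤⟨ ℤ.∣m⊝n∣≤m⊔n a b ⟩
          a ℕ.⊔ b            <⟨ ℕₚ.⊔-pres-<m a<q b<q ⟩
          q                  ≡⟨ ℕₚ.*-identityʳ q ⟨
          q ℕ.* 1            ∎
          where open ℕₚ.≤-Reasoning
        w≡0 : w ≡ + 0
        w≡0 = ℤ.∣i∣≡0⇒i≡0 (ℕₚ.n<1⇒n≡0 (ℕₚ.*-cancelˡ-< q _ _ q∣w∣<q))

    digit : (T : Subset k) → Fin (q ^ ∣ T ∣) → Fin k → ℕ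
    digit (outside ∷ T) x zero    = 0
    digit (outside ∷ T) x (suc i) = digit T x i
    digit (inside  ∷ T) x zero    = toℕ (proj₁ (remQuot {q} (q ^ ∣ T ∣) x))
    digit (inside  ∷ T) x (suc i) = digit T (proj₂ (remQuot {q} (q ^ ∣ T ∣) x)) i

    fromDigits : (T : Subset k) → (Fin k → Fin q) → Fin (q ^ ∣ T ∣)
    fromDigits []            f = zero
    fromDigits (outside ∷ T) f = fromDigits T (f ∘ suc)
    fromDigits (inside  ∷ T) f = combine (f zero) (fromDigits T (f ∘ suc))

    digit<q : (T : Subset k) (x : Fin (q ^ ∣ T ∣)) (i : Fin k) → digit T x i < q
    digit<q (outside ∷ T) x zero    = ℕ.>-nonZero⁻¹ q
    digit<q (outside ∷ T) x (suc i) = digit<q T x i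
    digit<q (inside  ∷ T) x zero    = Fin.toℕ<n _
    digit<q (inside  ∷ T) x (suc i) = digit<q T _ i

    digit-∉ : (T : Subset k) (x : Fin (q ^ ∣ T ∣)) (i : Fin k) → i ∉ T → digit T x i ≡ 0
    digit-∉ (outside ∷ T) x zero    _   = refl
    digit-∉ (outside ∷ T) x (suc i) i∉T = digit-∉ T x i (i∉T ∘ there)
    digit-∉ (inside  ∷ T) x zero    i∉T = ⊥-elim (i∉T here)
    digit-∉ (inside  ∷ T) x (suc i) i∉T = digit-∉ T _ i (i∉T ∘ there)

    digit-injective : (T : Subset k) {x y : Fin (q ^ ∣ T ∣)} → (∀ i → digit T x i ≡ digit T y i) → x ≡ y
    digit-injective []            {zero} {zero} _ = refl
    digit-injective (outside ∷ T) same = digit-injective T (same ∘ suc)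
    digit-injective (inside  ∷ T) {x} {y} same = begin
      x                                        ≡⟨ Fin.combine-remQuot {q} (q ^ ∣ T ∣) x ⟨
      combine (proj₁ (remQuot {q} _ x)) (proj₂ (remQuot {q} _ x))
        ≡⟨ cong₂ combine (Fin.toℕ-injective (same zero)) (digit-injective T (same ∘ suc)) ⟩
      combine (proj₁ (remQuot {q} _ y)) (proj₂ (remQuot {q} _ y))
                                               ≡⟨ Fin.combine-remQuot {q} (q ^ ∣ T ∣) y ⟩
      y ∎
      where open ≡-Reasoning

    digit-fromDigits : (T : Subset k) (f : Fin k → Fin q) (i : Fin k) → i ∈ T → digit T (fromDigits T f) i ≡ toℕ (f i)
    digit-fromDigits (outside ∷ T) f (suc i) (there i∈T) = digit-fromDigits T (f ∘ suc) i i∈T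
    digit-fromDigits (inside  ∷ T) f zero    _           =
      cong (toℕ ∘ proj₁) (Fin.remQuot-combine {q} {q ^ ∣ T ∣} (f zero) _)
    digit-fromDigits (inside  ∷ T) f (suc i) (there i∈T) =
      trans (cong (λ y → digit T (proj₂ y) i) (Fin.remQuot-combine {q} {q ^ ∣ T ∣} (f zero) _))
            (digit-fromDigits T (f ∘ suc) i i∈T)

    module _ (X : Config n k) where

      private
        qX = scale q X

      comb-scale : ∀ c → comb qX c ≡ (+ q) ·ᵥ comb X c
      comb-scale = comb-map (·ᵥ-isLinear (+ q)) X

      LinIndep-scale⁻ : ∀ {T} → LinIndep qX T → LinIndep X T
      LinIndep-scale⁻ indep c c-supp c-comb = indep c c-supp (begin
        comb qX c            ≡⟨ comb-scale c ⟩
        (+ q) ·ᵥ comb X c      ≡⟨ cong ((+ q) ·ᵥ_) c-comb ⟩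
        (+ q) ·ᵥ 0ᵥ            ≡⟨ ·ᵥ-zeroʳ (+ q) ⟩
        0ᵥ ∎)
        where open ≡-Reasoning

      LinIndep-scale⁺ : ∀ {T} → LinIndep X T → LinIndep qX T
      LinIndep-scale⁺ indep c c-supp c-comb = indep c c-supp (·ᵥ-cancelˡ (+ q) q≢0 (begin
        (+ q) ·ᵥ comb X c      ≡⟨ comb-scale c ⟨
        comb qX c            ≡⟨ c-comb ⟩
        0ᵥ                   ≡⟨ ·ᵥ-zeroʳ (+ q) ⟨
        (+ q) ·ᵥ 0ᵥ ∎))
        where open ≡-Reasoning

      rank-scale : ∀ {A r r′} → IsRank X A r → IsRank qX A r′ → r′ ≡ r
      rank-scale ((T , T⊆A , indep , refl) , maximal) ((T′ , T′⊆A , indep′ , refl) , maximal′) =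
        ℕₚ.≤-antisym (maximal T′ T′⊆A (LinIndep-scale⁻ indep′)) (maximal′ T T⊆A (LinIndep-scale⁺ indep))

      InZSpan-scale⁺ : ∀ {S v} → InZSpan X S v → InZSpan qX S ((+ q) ·ᵥ v)
      InZSpan-scale⁺ (c , c-supp , refl) = c , c-supp , comb-scale c

      InZSpan-scale⁻ : ∀ {S} → InZSpan qX S ⊆ₚ InZSpan X S
      InZSpan-scale⁻ {S} (c , c-supp , refl) =
        subst (InZSpan X S) (sym (comb-scale c)) (IsSubmodule.∈-·ᵥ (InZSpan-isSubmodule X S) (+ q) (c , c-supp , refl))

      InZSpan-scale-cancel : ∀ {S v} → InZSpan qX S ((+ q) ·ᵥ v) → InZSpan X S v
      InZSpan-scale-cancel (c , c-supp , c-comb) = c , c-supp , ·ᵥ-cancelˡ (+ q) q≢0 (trans (sym (comb-scale c)) c-comb)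

      InΛ-scale⁻ : ∀ {S} → InΛ qX S ⊆ₚ InΛ X S
      InΛ-scale⁻ (d , d≢0 , dv∈qZ) = d , d≢0 , InZSpan-scale⁻ dv∈qZ

      InΛ-scale⁺ : ∀ {S} → InΛ X S ⊆ₚ InΛ qX S
      InΛ-scale⁺ {S} {v} (d , d≢0 , dv∈Z) =
        + q * d , *-≢0 q≢0 d≢0 , subst (InZSpan qX S) (·ᵥ-assoc (+ q) d v) (InZSpan-scale⁺ dv∈Z)

      Index-scale : ∀ {A T m} → Index (InZSpan X A) (InZSpan X T) m → Index (InZSpan qX A) (InZSpan qX T) m
      Index-scale {A} {T} (ρ , ρ∈ , ρ-irredundant , ρ-complete) =
        ((+ q) ·ᵥ_) ∘ ρ , InZSpan-scale⁺ ∘ ρ∈ , irredundant , complete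
        where
          irredundant : ∀ j j′ → ((+ q) ·ᵥ ρ j) ∼[ InZSpan qX T ] ((+ q) ·ᵥ ρ j′) → j ≡ j′
          irredundant j j′ qρ∼qρ′ = ρ-irredundant j j′
            (InZSpan-scale-cancel (subst (InZSpan qX T) (sym (·ᵥ-distribˡ-−ᵥ (+ q) (ρ j) (ρ j′))) qρ∼qρ′))

          complete : ∀ v → InZSpan qX A v → ∃ λ j → v ∼[ InZSpan qX T ] ((+ q) ·ᵥ ρ j)
          complete _ (c , c-supp , refl) = j , subst (InZSpan qX T) scaled-difference (InZSpan-scale⁺ u∼ρj)
            where
              j = proj₁ (ρ-complete (comb X c) (c , c-supp , refl))
              u∼ρj = proj₂ (ρ-complete (comb X c) (c , c-supp , refl))
              scaled-difference : (+ q) ·ᵥ (comb X c -ᵥ ρ j) ≡ comb qX c -ᵥ ((+ q) ·ᵥ ρ j)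
              scaled-difference = trans (·ᵥ-distribˡ-−ᵥ (+ q) _ _) (cong (_-ᵥ ((+ q) ·ᵥ ρ j)) (sym (comb-scale c)))

      digitComb : (T : Subset k) → Fin (q ^ ∣ T ∣) → Vec ℤ n
      digitComb T x = comb X (λ i → + digit T x i)

      digitComb-injective : ∀ {T} → LinIndep X T → ∀ x y → digitComb T x ∼[ InZSpan qX T ] digitComb T y → x ≡ y
      digitComb-injective {T} indep x y (w , w-supp , w-comb) = digit-injective T λ i →
        digits-unique (digit<q T x i) (digit<q T y i) (ℤ.i-j≡0⇒i≡j _ _ (indep f f-supp f-comb i))
        where
          f : Fin k → ℤ
          f i = (+ digit T x i - + digit T y i) - + q * w i

          f-supp : SupportedOn T f
          f-supp i i∉T rewrite digit-∉ T x i i∉T | digit-∉ T y i i∉T | w-supp i i∉T =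
            cong (λ z → + 0 - z) (ℤ.*-zeroʳ (+ q))

          f-comb : comb X f ≡ 0ᵥ
          f-comb = begin
            comb X f                                                   ≡⟨ comb-− X _ _ ⟩
            comb X (λ i → + digit T x i - + digit T y i) -ᵥ comb X (λ i → + q * w i)
              ≡⟨ cong₂ _-ᵥ_ (comb-− X _ _) (trans (comb-· X (+ q) w) (sym (comb-scale w))) ⟩
            (digitComb T x -ᵥ digitComb T y) -ᵥ comb qX w              ≡⟨ cong (_ -ᵥ_) w-comb ⟩
            (digitComb T x -ᵥ digitComb T y) -ᵥ (digitComb T x -ᵥ digitComb T y)
                                                                       ≡⟨ v-v≡0 _ ⟩
            0ᵥ ∎
            where open ≡-Reasoning

      digitComb-complete : ∀ {T} v → InZSpan X T v → ∃ λ x → v ∼[ InZSpan qX T ] digitComb T x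
      digitComb-complete {T} _ (c , c-supp , refl) = x , w , w-supp , w-comb
        where
          x = fromDigits T (λ i → fromℕ< (n%ℕd<d (c i) q))
          w = λ i → c i /ℕ q

          digit≡%q : ∀ i → digit T x i ≡ c i %ℕ q
          digit≡%q i with i Subset.∈? T
          ... | yes i∈T = trans (digit-fromDigits T _ i i∈T) (Fin.toℕ-fromℕ< _)
          ... | no  i∉T = trans (digit-∉ T x i i∉T)
            (sym (trans (cong (_%ℕ q) (c-supp i i∉T)) (ℕ.m<n⇒m%n≡m (ℕ.>-nonZero⁻¹ q))))

          w-supp : SupportedOn T w
          w-supp i i∉T = trans (cong (_/ℕ q) (c-supp i i∉T)) (cong +_ (ℕ.0/n≡0 q))

          c-digit≡qw : ∀ i → c i - + digit T x i ≡ + q * w i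
          c-digit≡qw i = begin
            c i - + digit T x i                          ≡⟨ cong (λ r → c i - + r) (digit≡%q i) ⟩
            c i - + (c i %ℕ q)                           ≡⟨ cong (_- + (c i %ℕ q)) (a≡a%ℕn+[a/ℕn]*n (c i) q) ⟩
            (+ (c i %ℕ q) + w i * + q) - + (c i %ℕ q)    ≡⟨ ring (+ (c i %ℕ q)) (w i) (+ q) ⟩
            + q * w i ∎
            where
              open ≡-Reasoning
              ring : ∀ r d q → (r + d * q) - r ≡ q * d
              ring = solve-∀

          w-comb : comb qX w ≡ comb X c -ᵥ digitComb T x
          w-comb = begin
            comb qX w                                ≡⟨ comb-scale w ⟩
            (+ q) ·ᵥ comb X w                        ≡⟨ comb-· X (+ q) w ⟨
            comb X (λ i → + q * w i)                 ≡⟨ comb-cong X c-digit≡qw ⟨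
            comb X (λ i → c i - + digit T x i)       ≡⟨ comb-− X c _ ⟩
            comb X c -ᵥ digitComb T x ∎
            where open ≡-Reasoning

      -- The combinations of an independent T with digits in [0, q) represent ⟨T⟩_ℤ / q⟨T⟩_ℤ.
      Index-digits : ∀ {T} → LinIndep X T → Index (InZSpan X T) (InZSpan qX T) (q ^ ∣ T ∣)
      Index-digits {T} indep =
        digitComb T ,
        (λ x → (λ i → + digit T x i) , (λ i i∉T → cong +_ (digit-∉ T x i i∉T)) , refl) ,
        digitComb-injective indep ,
        digitComb-complete

      index-scale : ∀ {A r} (m m′ : Subset k → ℕ) → IsRank X A r →
        (∀ A → IsIndex X A (m A)) → (∀ A → IsIndex qX A (m′ A)) → m′ A ≡ q ^ r ℕ.* m A
      index-scale {A} m m′ ((T , T⊆A , indep , refl) , maximal) isIndex isIndex′ =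
        ℕₚ.*-cancelʳ-≡ (m′ A) (q ^ ∣ T ∣ ℕ.* m A) c {{c≢0}} (begin
          m′ A ℕ.* c                 ≡⟨ m′T≡m′A*c ⟨
          m′ T                       ≡⟨ m′T≡mT*q^∣T∣ ⟩
          m T ℕ.* q ^ ∣ T ∣          ≡⟨ cong (ℕ._* q ^ ∣ T ∣) mT≡mA*c ⟩
          m A ℕ.* c ℕ.* q ^ ∣ T ∣    ≡⟨ ℕₚ.*-comm (m A ℕ.* c) (q ^ ∣ T ∣) ⟩
          q ^ ∣ T ∣ ℕ.* (m A ℕ.* c)  ≡⟨ ℕₚ.*-assoc (q ^ ∣ T ∣) (m A) c ⟨
          q ^ ∣ T ∣ ℕ.* m A ℕ.* c    ∎)
        where
          open ≡-Reasoning
          Λ = InΛ X A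
          Λ-sub  = IsSubmodule.isSubgroup (InΛ-isSubmodule X A)
          ZA-sub = IsSubmodule.isSubgroup (InZSpan-isSubmodule X A)
          ZT-sub = IsSubmodule.isSubgroup (InZSpan-isSubmodule X T)
          qZA-sub = IsSubmodule.isSubgroup (InZSpan-isSubmodule qX A)
          qZT-sub = IsSubmodule.isSubgroup (InZSpan-isSubmodule qX T)
          ZA⊆Λ : InZSpan X A ⊆ₚ Λ
          ZA⊆Λ = InZSpan⊆InΛ X A
          ZT⊆ZA : InZSpan X T ⊆ₚ InZSpan X A
          ZT⊆ZA = InZSpan-mono X T⊆A
          ZT⊆Λ : InZSpan X T ⊆ₚ Λ
          ZT⊆Λ = ZA⊆Λ ∘ ZT⊆ZA
          qZT⊆ZT : InZSpan qX T ⊆ₚ InZSpan X T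
          qZT⊆ZT = InZSpan-scale⁻
          qZT⊆qZA : InZSpan qX T ⊆ₚ InZSpan qX A
          qZT⊆qZA = InZSpan-mono qX T⊆A
          qZA⊆Λ : InZSpan qX A ⊆ₚ Λ
          qZA⊆Λ = ZA⊆Λ ∘ InZSpan-scale⁻
          Λ_T⊆Λ : InΛ X T ⊆ₚ Λ
          Λ_T⊆Λ = InΛ-mono X T⊆A
          Λ⊆Λ_T : Λ ⊆ₚ InΛ X T
          Λ⊆Λ_T = InΛ-basis X T⊆A indep maximal

          [Λ:ZA] : Index Λ (InZSpan X A) (m A)
          [Λ:ZA] = isIndex A
          [Λ:qZA] : Index Λ (InZSpan qX A) (m′ A)
          [Λ:qZA] = Index-congˡ {H = InZSpan qX A} InΛ-scale⁻ InΛ-scale⁺ (isIndex′ A)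
          [Λ:ZT] : Index Λ (InZSpan X T) (m T)
          [Λ:ZT] = Index-congˡ {H = InZSpan X T} Λ_T⊆Λ Λ⊆Λ_T (isIndex T)
          [Λ:qZT] : Index Λ (InZSpan qX T) (m′ T)
          [Λ:qZT] = Index-congˡ {H = InZSpan qX T} (Λ_T⊆Λ ∘ InΛ-scale⁻) (InΛ-scale⁺ ∘ Λ⊆Λ_T) (isIndex′ T)

          c = proj₁ (Index-intermediate Λ-sub ZA-sub ZA⊆Λ ZT⊆ZA [Λ:ZT] [Λ:ZA])
          [ZA:ZT] : Index (InZSpan X A) (InZSpan X T) c
          [ZA:ZT] = proj₂ (Index-intermediate Λ-sub ZA-sub ZA⊆Λ ZT⊆ZA [Λ:ZT] [Λ:ZA])
          [qZA:qZT] : Index (InZSpan qX A) (InZSpan qX T) c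
          [qZA:qZT] = Index-scale [ZA:ZT]
          c≢0 : ℕ.NonZero c
          c≢0 = Fin.nonZeroIndex (proj₁ (proj₂ (proj₂ (proj₂ [ZA:ZT])) 0ᵥ (IsSubgroup.∈-0ᵥ ZA-sub)))

          mT≡mA*c : m T ≡ m A ℕ.* c
          mT≡mA*c = Index-unique ZT-sub [Λ:ZT] (Index-* Λ-sub ZA-sub ZA⊆Λ ZT⊆ZA [Λ:ZA] [ZA:ZT])
          m′T≡m′A*c : m′ T ≡ m′ A ℕ.* c
          m′T≡m′A*c = Index-unique qZT-sub [Λ:qZT] (Index-* Λ-sub qZA-sub qZA⊆Λ qZT⊆qZA [Λ:qZA] [qZA:qZT])
          m′T≡mT*q^∣T∣ : m′ T ≡ m T ℕ.* q ^ ∣ T ∣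
          m′T≡mT*q^∣T∣ = Index-unique qZT-sub [Λ:qZT] (Index-* Λ-sub ZT-sub ZT⊆Λ qZT⊆ZT [Λ:ZT] (Index-digits indep))

open Lattice using (rank≤n; rank-scale; index-scale)

open import Data.Nat using (ℕ; NonZero)
open import Data.Integer using (+_)
open import Data.Rational using (ℚ; _+_; _-_; _*_; _/_; 1ℚ)
open import Data.Fin.Subset using (Subset)
open import Relation.Binary.PropositionalEquality using (_≡_)

import Data.Nat as ℕ
import Data.Nat.Properties as ℕₚ
import Data.Nat.Coprimality as Coprimality
import Data.Integer.Properties as ℤ
open import Data.Rational using (mkℚ)
import Data.Rational.Properties as ℚ
open import Data.Rational.Solver using (module +-*-Solver)
open import Algebra.Bundles using (CommutativeRing; CommutativeSemiring)
open import Data.Fin.Subset using (inside; outside; ∣_∣)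
open import Data.Vec using (_∷_)
open import Function using (_∘_)
open import Relation.Binary.PropositionalEquality using (refl; sym; trans; cong; cong₂; module ≡-Reasoning)

open CommutativeRing ℚ.+-*-commutativeRing using (commutativeSemiring)
open import Algebra.Properties.CommutativeSemiring.Exp commutativeSemiring using (^-homo-*; ^-distrib-*)
open import Algebra.Definitions.RawSemiring (CommutativeSemiring.rawSemiring commutativeSemiring) using (_^_)

^ℚ≡^ : ∀ x e → x ^ℚ e ≡ x ^ e
^ℚ≡^ x ℕ.zero    = refl
^ℚ≡^ x (ℕ.suc e) = cong (x *_) (^ℚ≡^ x e)

^ℚ-homo-+ : ∀ x a b → x ^ℚ (a ℕ.+ b) ≡ x ^ℚ a * x ^ℚ b
^ℚ-homo-+ x a b = trans (^ℚ≡^ x (a ℕ.+ b)) (trans (^-homo-* x a b) (sym (cong₂ _*_ (^ℚ≡^ x a) (^ℚ≡^ x b))))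

^ℚ-distrib-* : ∀ x y e → (x * y) ^ℚ e ≡ x ^ℚ e * y ^ℚ e
^ℚ-distrib-* x y e = trans (^ℚ≡^ (x * y) e) (trans (^-distrib-* x y e) (sym (cong₂ _*_ (^ℚ≡^ x e) (^ℚ≡^ y e))))

-- `+ a / 1` is stuck on a gcd for variable a; ι a is the fraction it normalises to, on which _*_ computes.
private
  ι : ℕ → ℚ
  ι a = mkℚ (+ a) 0 (Coprimality.sym (Coprimality.1-coprimeTo a))

  a/1≡ι : ∀ a → + a / 1 ≡ ι a
  a/1≡ι a = ℚ.↥p/↧p≡p (ι a)

/1-homo-* : ∀ a b → + (a ℕ.* b) / 1 ≡ (+ a / 1) * (+ b / 1)
/1-homo-* a b = trans (cong (_/ 1) (ℤ.pos-* a b)) (sym (cong₂ _*_ (a/1≡ι a) (a/1≡ι b)))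

/1-homo-^ : ∀ q r → + (q ℕ.^ r) / 1 ≡ (+ q / 1) ^ℚ r
/1-homo-^ q ℕ.zero    = refl
/1-homo-^ q (ℕ.suc r) = trans (/1-homo-* q (q ℕ.^ r)) (cong ((+ q / 1) *_) (/1-homo-^ q r))

q*1/q≡1 : ∀ q′ → (+ ℕ.suc q′ / 1) * (+ 1 / ℕ.suc q′) ≡ 1ℚ
q*1/q≡1 q′ = trans (cong₂ _*_ (a/1≡ι (ℕ.suc q′)) (ℚ.↥p/↧p≡p (mkℚ (+ 1) q′ (Coprimality.1-coprimeTo _))))
                   (ℚ.*-inverseʳ (ι (ℕ.suc q′)))

sumSub-cong : ∀ {k} {f g : Subset k → ℚ} → (∀ A → f A ≡ g A) → sumSub f ≡ sumSub g
sumSub-cong {ℕ.zero}  f≗g = f≗g _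
sumSub-cong {ℕ.suc k} f≗g = cong₂ _+_ (sumSub-cong (f≗g ∘ (outside ∷_))) (sumSub-cong (f≗g ∘ (inside ∷_)))

sumSub-*ˡ : ∀ {k} (c : ℚ) (f : Subset k → ℚ) → sumSub (λ A → c * f A) ≡ c * sumSub f
sumSub-*ˡ {ℕ.zero}  c f = refl
sumSub-*ˡ {ℕ.suc k} c f =
  trans (cong₂ _+_ (sumSub-*ˡ c (f ∘ (outside ∷_))) (sumSub-*ˡ c (f ∘ (inside ∷_)))) (sym (ℚ.*-distribˡ-+ c _ _))

term-scale : ∀ q′ (n r r′ m m′ : ℕ) (U : ℚ) (V : ℕ → ℚ) →
  r′ ≡ r → m′ ≡ ℕ.suc q′ ℕ.^ r ℕ.* m → r ℕ.≤ n →
  (+ m′ / 1) * (U ^ℚ (n ℕ.∸ r′) * V r′)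
    ≡ ((+ ℕ.suc q′ / 1) ^ℚ n) * ((+ m / 1) * ((((U * (+ 1 / ℕ.suc q′)) + 1ℚ) - 1ℚ) ^ℚ (n ℕ.∸ r) * V r))
term-scale q′ n r .r m .(ℕ.suc q′ ℕ.^ r ℕ.* m) U V refl refl r≤n = begin
  (+ (q ℕ.^ r ℕ.* m) / 1) * (U ^ℚ e * Y)
    ≡⟨ cong (_* (U ^ℚ e * Y)) (trans (/1-homo-* (q ℕ.^ r) m) (cong (_* M) (/1-homo-^ q r))) ⟩
  (Q ^ℚ r * M) * (U ^ℚ e * Y)
    ≡⟨ cong (λ z → (Q ^ℚ r * M) * (z ^ℚ e * Y)) (solve-U U) ⟩
  (Q ^ℚ r * M) * ((Q * (U * 1/q)) ^ℚ e * Y)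
    ≡⟨ cong (λ z → (Q ^ℚ r * M) * (z * Y)) (^ℚ-distrib-* Q (U * 1/q) e) ⟩
  (Q ^ℚ r * M) * ((Q ^ℚ e * (U * 1/q) ^ℚ e) * Y)
    ≡⟨ solve-regroup (Q ^ℚ r) M (Q ^ℚ e) ((U * 1/q) ^ℚ e) Y ⟩
  (Q ^ℚ r * Q ^ℚ e) * (M * ((U * 1/q) ^ℚ e * Y))
    ≡⟨ cong₂ (λ a b → a * (M * (b ^ℚ e * Y)))
             (trans (sym (^ℚ-homo-+ Q r e)) (cong (Q ^ℚ_) (ℕₚ.m+[n∸m]≡n r≤n))) (solve-+1-1 (U * 1/q)) ⟩
  Q ^ℚ n * (M * ((((U * 1/q) + 1ℚ) - 1ℚ) ^ℚ e * Y)) ∎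
  where
    open ≡-Reasoning
    open +-*-Solver
    q = ℕ.suc q′
    Y = V r
    Q = + q / 1
    1/q = + 1 / q
    M = + m / 1
    e = n ℕ.∸ r
    solve-U : ∀ U → U ≡ Q * (U * 1/q)
    solve-U U = trans (solve 1 (λ U → U := U :* con 1ℚ) refl U)
      (trans (cong (U *_) (sym (q*1/q≡1 q′))) (solve 3 (λ U Q i → U :* (Q :* i) := Q :* (U :* i)) refl U Q 1/q))
    solve-regroup : ∀ a b c d f → (a * b) * ((c * d) * f) ≡ (a * c) * (b * (d * f))
    solve-regroup = solve 5 (λ a b c d f → (a :* b) :* ((c :* d) :* f) := (a :* c) :* (b :* (d :* f))) refl
    solve-+1-1 : ∀ a → a ≡ (a + 1ℚ) - 1ℚ
    solve-+1-1 = solve 1 (λ a → a := (a :+ con 1ℚ) :- con 1ℚ) refl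

lemma3p1 : ∀ {n k} (X : Config n k) (q : ℕ) .{{_ : NonZero q}} → Spans X
    → (r m r′ m′ : Subset k → ℕ)
    → (∀ A → IsRank X A (r A)) → (∀ A → IsIndex X A (m A))
    → (∀ A → IsRank (scale q X) A (r′ A)) → (∀ A → IsIndex (scale q X) A (m′ A))
    → ∀ (x y : ℚ)
    → MTutte n r′ m′ x y ≡ ((+ q / 1) ^ℚ n) * MTutte n r m (((x - 1ℚ) * (+ 1 / q)) + 1ℚ) y
lemma3p1 {n} {k} X q@(ℕ.suc q′) _ r m r′ m′ isRank isIndex isRank′ isIndex′ x y =
  trans (sumSub-cong λ A →
           term-scale q′ n (r A) (r′ A) (m A) (m′ A) (x - 1ℚ) (λ s → (y - 1ℚ) ^ℚ (∣ A ∣ ℕ.∸ s))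
             (rank-scale q X (isRank A) (isRank′ A)) (index-scale q X m m′ (isRank A) isIndex isIndex′)
             (rank≤n X (isRank A)))
        (sumSub-*ˡ {k} ((+ q / 1) ^ℚ n) _)
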